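{- For all integers $a,b,m$ with $\gcd(a,m)=1$ and all $n\in\mathbb{N}_+$, we have $|\mathcal{T}_n/{\equiv_{a,b\bmod m}}|\ge|\mathcal{T}_n/{\equiv^R_m}|$.
   Context: $\mathcal{T}_n$ is the set of binary trees (rooted plane trees, each internal vertex with an ordered left and right child) with $n$ leaves, numbered $1,\dots,n$ from left to right. For a leaf $i$, $\mathrm{ld}_T(i)$ and $\mathrm{rd}_T(i)$ are the numbers of left and right steps on the path from the root to $i$. Congruence modulo $m$ means $m$ divides the difference (modulo $0$ means equality). $T\equiv_{a,b\bmod m}T'$ iff $a\,\mathrm{ld}_T(i)+b\,\mathrm{rd}_T(i)\equiv a\,\mathrm{ld}_{T'}(i)+b\,\mathrm{rd}_{T'}(i)\pmod m$ for all $i$; $T\equiv^R_mT'$ iff $\mathrm{rd}_T(i)\equiv\mathrm{rd}_{T'}(i)\pmod m$ for all $i$. -}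

module Defs where

open import Data.Nat using (ℕ; suc; _+_)
open import Data.Integer as ℤ using (ℤ; +_; _-_)
open import Data.Integer.Divisibility using (_∣_)
open import Data.Fin using (Fin)
open import Data.Product using (_×_; _,_; proj₁; proj₂)
open import Data.Vec using (Vec; []; _∷_; _++_; map; lookup)

data Tree : ℕ → Set where
  leaf : Tree 1
  node : ∀ {i j} → Tree i → Tree j → Tree (i + j)

depths : ∀ {n} → Tree n → Vec (ℕ × ℕ) n
depths leaf = (0 , 0) ∷ []
depths (node l r) =
  map (λ p → (suc (proj₁ p) , proj₂ p)) (depths l)
  ++ map (λ p → (proj₁ p , suc (proj₂ p))) (depths r)

-- ld_T(i) and rd_T(i); leaves are numbered 0,…,n-1 (Fin n) from left to right.
ld : ∀ {n} → Tree n → Fin n → ℕ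
ld T i = proj₁ (lookup (depths T) i)

rd : ∀ {n} → Tree n → Fin n → ℕ
rd T i = proj₂ (lookup (depths T) i)

-- Congruence modulo m on ℤ: m divides the difference (mod 0 = equality).
_≡_[mod_] : ℤ → ℤ → ℤ → Set
x ≡ y [mod m ] = m ∣ (x - y)

ABCong : ℤ → ℤ → ℤ → ∀ {n} → Tree n → Tree n → Set
ABCong a b m {n} T T' =
  ∀ (i : Fin n) →
    (a ℤ.* + ld T i ℤ.+ b ℤ.* + rd T i) ≡ (a ℤ.* + ld T' i ℤ.+ b ℤ.* + rd T' i) [mod m ]

RCong : ℤ → ∀ {n} → Tree n → Tree n → Set
RCong m {n} T T' = ∀ (i : Fin n) → (+ rd T i) ≡ (+ rd T' i) [mod m ]

module Submission where

-- A tree is determined by its sequence of right depths, and read backwards this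
-- sequence has the shape of a left-depth sequence: positive except for a final 0,
-- and dropping by at most one from each entry to the next.  Given T, choose from left
-- to right the least left depths of that shape congruent mod m to the reversed right
-- depths of T, and let f T be the tree with these left depths, built by repeatedly
-- inserting a new leftmost leaf.  The choice only sees residues, so f respects ≡^R_m.
-- In such a tree the right depth of a leaf is determined by the left depths of the
-- leaves before it.  Hence if f T ≡_{a,b mod m} f T', going through the leaves from
-- left to right the right depths agree, cancelling the unit a shows that the left
-- depths agree mod m, and minimality of the greedy choice makes them equal; so f T
-- and f T' encode the same residues, i.e. T ≡^R_m T'.

open import Defs
open import Data.Bool using (true; false; if_then_else_)
open import Data.Empty using (⊥)
open import Data.Fin using (zero; suc; toℕ; inject₁)
open import Data.Fin.Properties using (toℕ-inject₁)
open import Data.Integer as ℤ using (ℤ; +_; _-_; 1ℤ)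
import Data.Integer.Divisibility.Signed as ℤˢ
open import Data.Integer.GCD using (gcd)
import Data.Integer.Properties as ℤ
open import Data.Integer.Tactic.RingSolver using (solve-∀)
open import Data.List as List using (List)
import Data.List.Properties as Listₚ
open import Data.Nat as ℕ using (ℕ; zero; suc; pred; _≤_; _<_; z≤n; s≤s; _≤ᵇ_; _<ᵇ_)
import Data.Nat.Coprimality as ℕ
import Data.Nat.Divisibility as ℕ
import Data.Nat.Properties as ℕ
open import Data.Product using (Σ; _×_; _,_; proj₁; proj₂; map₁; map₂)
open import Data.Sum using (inj₁; inj₂)
open import Data.Unit using (⊤; tt)
open import Data.Vec using (Vec; []; _∷_; _∷ʳ_; _++_; head; map; lookup; reverse; toList)
import Data.Vec.Properties as Vecₚ
import Data.Vec.Relation.Binary.Pointwise.Extensional as Ext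
open import Data.Vec.Relation.Binary.Pointwise.Inductive as Pw using (Pointwise; []; _∷_)
open import Function using (_∘_)
open import Function.Definitions using (Congruent; Injective)
open import Relation.Binary using (Rel)
open import Relation.Binary.PropositionalEquality
open import Relation.Nullary using (yes; no; contradiction)
open import Relation.Nullary.Decidable using (map′)
open import Relation.Unary using (Pred; Decidable; _≐_)

-- Congruence modulo m

module _ (m : ℤ) where

  ≡-mod-refl : ∀ x → x ≡ x [mod m ]
  ≡-mod-refl x rewrite ℤ.+-inverseʳ x = ℕ._∣0 ℤ.∣ m ∣

  ≡-mod-sym : ∀ x y → x ≡ y [mod m ] → y ≡ x [mod m ]
  ≡-mod-sym x y = subst (ℕ._∣_ ℤ.∣ m ∣) (ℤ.∣i-j∣≡∣j-i∣ x y)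

  ≡-mod-trans : ∀ x y z → x ≡ y [mod m ] → y ≡ z [mod m ] → x ≡ z [mod m ]
  ≡-mod-trans x y z m∣x-y m∣y-z =
    ℤˢ.∣⇒∣ᵤ (subst (ℤˢ._∣_ m) (telescope x y z)
      (ℤˢ.∣m∣n⇒∣m+n (ℤˢ.∣ᵤ⇒∣ {m} {x - y} m∣x-y) (ℤˢ.∣ᵤ⇒∣ {m} {y - z} m∣y-z)))
    where
    telescope : ∀ x y z → (x - y) ℤ.+ (y - z) ≡ x - z
    telescope = solve-∀

  ≡-mod-cancelʳ-+ : ∀ x y c → (x ℤ.+ c) ≡ (y ℤ.+ c) [mod m ] → x ≡ y [mod m ]
  ≡-mod-cancelʳ-+ x y c = subst (λ d → ℕ._∣_ ℤ.∣ m ∣ ℤ.∣ d ∣) (difference x y c)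
    where
    difference : ∀ x y c → (x ℤ.+ c) - (y ℤ.+ c) ≡ x - y
    difference = solve-∀

  ≡-mod-cancelˡ-* : ∀ a x y → gcd a m ≡ 1ℤ → (a ℤ.* x) ≡ (a ℤ.* y) [mod m ] → x ≡ y [mod m ]
  ≡-mod-cancelˡ-* a x y gcd≡1 m∣ax-ay =
    ℕ.coprime-divisor {ℤ.∣ m ∣} {ℤ.∣ a ∣} {ℤ.∣ x - y ∣}
      (ℕ.sym {ℤ.∣ a ∣} {ℤ.∣ m ∣} (ℕ.gcd≡1⇒coprime {ℤ.∣ a ∣} {ℤ.∣ m ∣} (cong ℤ.∣_∣ gcd≡1)))
      (subst (ℕ._∣_ ℤ.∣ m ∣) (trans (cong ℤ.∣_∣ (factor a x y)) (ℤ.abs-* a (x - y))) m∣ax-ay)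
    where
    factor : ∀ a x y → a ℤ.* x - a ℤ.* y ≡ a ℤ.* (x - y)
    factor = solve-∀

ABCong-refl : ∀ a b m {n} (S : Tree n) → ABCong a b m S S
ABCong-refl a b m S i = ≡-mod-refl m (a ℤ.* + ld S i ℤ.+ b ℤ.* + rd S i)

ABCong⇒ld-≡-mod : ∀ a b m → gcd a m ≡ 1ℤ → ∀ {n} (S S' : Tree n) i → rd S i ≡ rd S' i →
  ABCong a b m S S' → (+ ld S i) ≡ (+ ld S' i) [mod m ]
ABCong⇒ld-≡-mod a b m gcd≡1 S S' i rd≡rd' S≡S' =
  ≡-mod-cancelˡ-* m a (+ ld S i) (+ ld S' i) gcd≡1
    (≡-mod-cancelʳ-+ m (a ℤ.* + ld S i) (a ℤ.* + ld S' i) (b ℤ.* + rd S i)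
      (subst (λ r → (a ℤ.* + ld S i ℤ.+ b ℤ.* + rd S i) ≡ (a ℤ.* + ld S' i ℤ.+ b ℤ.* + r) [mod m ])
        (sym rd≡rd') (S≡S' i)))

firstFrom : ∀ {ℓ} {P : Pred ℕ ℓ} → Decidable P → ℕ → ℕ → ℕ
firstFrom P? lb zero    = lb
firstFrom P? lb (suc F) with P? lb
... | yes _ = lb
... | no  _ = firstFrom P? (suc lb) F

module _ {ℓ} {P : Pred ℕ ℓ} (P? : Decidable P) where

  firstFrom-spec : ∀ {lb F z} → lb ≤ z → z < lb ℕ.+ F → P z →
    let v = firstFrom P? lb F in P v × lb ≤ v × v ≤ z
  firstFrom-spec {lb} {zero} lb≤z z<lb+0 Pz =
    contradiction (ℕ.<-≤-trans z<lb+0 (subst (_≤ _) (sym (ℕ.+-identityʳ lb)) lb≤z)) (ℕ.<-irrefl refl)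
  firstFrom-spec {lb} {suc F} {z} lb≤z z<lb+F Pz with P? lb
  ... | yes Plb = Plb , ℕ.≤-refl , lb≤z
  ... | no ¬Plb with ℕ.m≤n⇒m<n∨m≡n lb≤z
  ...   | inj₂ refl = contradiction Pz ¬Plb
  ...   | inj₁ lb<z =
    let Pv , 1+lb≤v , v≤z = firstFrom-spec lb<z (subst (z <_) (ℕ.+-suc lb F) z<lb+F) Pz
    in Pv , ℕ.<⇒≤ 1+lb≤v , v≤z

firstFrom-cong : ∀ {ℓ} {P Q : Pred ℕ ℓ} (P? : Decidable P) (Q? : Decidable Q) → P ≐ Q →
  ∀ lb F → firstFrom P? lb F ≡ firstFrom Q? lb F
firstFrom-cong P? Q? P≐Q lb zero = refl
firstFrom-cong P? Q? P≐Q@(P⊆Q , Q⊆P) lb (suc F) with P? lb | Q? lb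
... | yes _   | yes _   = refl
... | no  _   | no  _   = firstFrom-cong P? Q? P≐Q (suc lb) F
... | yes Plb | no ¬Qlb = contradiction (P⊆Q Plb) ¬Qlb
... | no ¬Plb | yes Qlb = contradiction (Q⊆P Qlb) ¬Plb

AgreeUpTo : ∀ {A : Set} {k} → ℕ → Vec A k → Vec A k → Set
AgreeUpTo _       []       []       = ⊤
AgreeUpTo zero    (_ ∷ _)  (_ ∷ _)  = ⊤
AgreeUpTo (suc j) (x ∷ xs) (y ∷ ys) = x ≡ y × AgreeUpTo j xs ys

≡-from-prefixes : ∀ {A : Set} {k} (xs ys : Vec A k) →
  (∀ i → AgreeUpTo (toℕ i) xs ys → lookup xs i ≡ lookup ys i) → xs ≡ ys
≡-from-prefixes []       []       step = refl
≡-from-prefixes (x ∷ xs) (y ∷ ys) step =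
  cong₂ _∷_ x≡y (≡-from-prefixes xs ys (λ i agree → step (suc i) (x≡y , agree)))
  where x≡y = step zero tt

module _ {A : Set} {ℓ} {R : Rel A ℓ} where

  ∷ʳ⁺ : ∀ {k x y} {xs ys : Vec A k} → Pointwise R xs ys → R x y → Pointwise R (xs ∷ʳ x) (ys ∷ʳ y)
  ∷ʳ⁺ []         Rxy = Rxy ∷ []
  ∷ʳ⁺ (Rx ∷ Rxs) Rxy = Rx ∷ ∷ʳ⁺ Rxs Rxy

  reverse⁺ : ∀ {k} {xs ys : Vec A k} → Pointwise R xs ys → Pointwise R (reverse xs) (reverse ys)
  reverse⁺ [] = []
  reverse⁺ {xs = x ∷ xs} {y ∷ ys} (Rxy ∷ Rxs)
    rewrite Vecₚ.reverse-∷ x xs | Vecₚ.reverse-∷ y ys = ∷ʳ⁺ (reverse⁺ Rxs) Rxy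

  reverse⁻ : ∀ {k} {xs ys : Vec A k} → Pointwise R (reverse xs) (reverse ys) → Pointwise R xs ys
  reverse⁻ {xs = xs} {ys} R-rev =
    subst₂ (Pointwise R) (Vecₚ.reverse-involutive xs) (Vecₚ.reverse-involutive ys) (reverse⁺ R-rev)

-- Inserting a new leftmost leaf

leftSpine : ∀ {n} → Tree n → ℕ
leftSpine leaf       = 0
leftSpine (node l r) = suc (leftSpine l)

OnlyLastOnRightSpine : ∀ {k} → Vec (ℕ × ℕ) k → Set
OnlyLastOnRightSpine []                     = ⊥
OnlyLastOnRightSpine ((zero  , _) ∷ [])    = ⊤
OnlyLastOnRightSpine ((zero  , _) ∷ _ ∷ _) = ⊥
OnlyLastOnRightSpine ((suc _ , _) ∷ xs)    = OnlyLastOnRightSpine xs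

OnlyLastOnRightSpine-++ : ∀ {i j} (X : Vec (ℕ × ℕ) i) {Y : Vec (ℕ × ℕ) j} →
  OnlyLastOnRightSpine Y → OnlyLastOnRightSpine (map (map₁ suc) X ++ Y)
OnlyLastOnRightSpine-++ []      only = only
OnlyLastOnRightSpine-++ (_ ∷ X) only = OnlyLastOnRightSpine-++ X only

OnlyLastOnRightSpine-map₂ : ∀ {k} (X : Vec (ℕ × ℕ) k) →
  OnlyLastOnRightSpine X → OnlyLastOnRightSpine (map (map₂ suc) X)
OnlyLastOnRightSpine-map₂ ((zero  , _) ∷ []) only = only
OnlyLastOnRightSpine-map₂ ((suc _ , _) ∷ X)  only = OnlyLastOnRightSpine-map₂ X only

OnlyLastOnRightSpine-depths : ∀ {n} (T : Tree n) → OnlyLastOnRightSpine (depths T)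
OnlyLastOnRightSpine-depths leaf       = tt
OnlyLastOnRightSpine-depths (node l r) =
  OnlyLastOnRightSpine-++ (depths l) (OnlyLastOnRightSpine-map₂ (depths r) (OnlyLastOnRightSpine-depths r))

-- The effect of insert d on the depths of the old leaves: one more right step for
-- those of the subtree that becomes a right child, i.e. from the old leftmost leaf
-- up to the first leaf of left depth ≤ d.
bump : ∀ {k} → ℕ → Vec (ℕ × ℕ) k → Vec (ℕ × ℕ) k
bump d []             = []
bump d ((x , y) ∷ xs) = (x , suc y) ∷ (if x ≤ᵇ d then xs else bump d xs)

bump-zero : ∀ {k} (X : Vec (ℕ × ℕ) k) → OnlyLastOnRightSpine X → bump 0 X ≡ map (map₂ suc) X
bump-zero ((zero  , y) ∷ []) _    = refl
bump-zero ((suc x , y) ∷ X)  only = cong ((suc x , suc y) ∷_) (bump-zero X only)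

bump-suc : ∀ {i j} d (X : Vec (ℕ × ℕ) i) (Y : Vec (ℕ × ℕ) j) → OnlyLastOnRightSpine X →
  bump (suc d) (map (map₁ suc) X ++ Y) ≡ map (map₁ suc) (bump d X) ++ Y
bump-suc d ((zero  , y) ∷ []) Y _ = refl
bump-suc d ((suc x , y) ∷ X)  Y only with x <ᵇ d
... | true  = refl
... | false = cong ((suc (suc x) , suc y) ∷_) (bump-suc d X Y only)

map-proj₁-bump : ∀ {k} d (X : Vec (ℕ × ℕ) k) → map proj₁ (bump d X) ≡ map proj₁ X
map-proj₁-bump d []            = refl
map-proj₁-bump d ((x , y) ∷ X) with x ≤ᵇ d
... | true  = refl
... | false = cong (x ∷_) (map-proj₁-bump d X)

bump-rd : ∀ {k} d (X X' : Vec (ℕ × ℕ) k) i →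
  AgreeUpTo (toℕ i) (map proj₁ X) (map proj₁ X') → proj₂ (lookup X i) ≡ proj₂ (lookup X' i) →
  proj₂ (lookup (bump d X) i) ≡ proj₂ (lookup (bump d X') i)
bump-rd d (_ ∷ _)       (_ ∷ _)         zero    _              y≡y' = cong suc y≡y'
bump-rd d ((x , _) ∷ X) ((.x , _) ∷ X') (suc i) (refl , agree) y≡y' with x ≤ᵇ d
... | true  = y≡y'
... | false = bump-rd d X X' i agree y≡y'

-- The second clause is junk: insert d Q is only used with d ≤ leftSpine Q.
insert : ∀ {n} → ℕ → Tree n → Tree (suc n)
insert zero    Q          = node leaf Q
insert (suc d) leaf       = node leaf leaf
insert (suc d) (node A B) = node (insert d A) B

depths-insert : ∀ {n} d (Q : Tree n) → d ≤ leftSpine Q →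
  depths (insert d Q) ≡ (suc d , 0) ∷ bump d (depths Q)
depths-insert zero    Q          _ =
  cong ((1 , 0) ∷_) (sym (bump-zero (depths Q) (OnlyLastOnRightSpine-depths Q)))
depths-insert (suc d) (node A B) (s≤s d≤spine) rewrite depths-insert d A d≤spine =
  cong ((suc (suc d) , 0) ∷_)
    (sym (bump-suc d (depths A) (map (map₂ suc) (depths B)) (OnlyLastOnRightSpine-depths A)))

leftSpine-insert : ∀ {n} d (Q : Tree n) → d ≤ leftSpine Q → leftSpine (insert d Q) ≡ suc d
leftSpine-insert zero    Q          _             = refl
leftSpine-insert (suc d) (node A B) (s≤s d≤spine) = cong suc (leftSpine-insert d A d≤spine)

-- Canonical trees

-- A code dᵢ stands for the left depth suc dᵢ of leaf i; the last leaf, of left depth 0,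
-- has no code.
Admissible : ∀ {k} → Vec ℕ k → Set
Admissible []            = ⊤
Admissible (d ∷ [])      = d ≡ 0
Admissible (d ∷ d' ∷ ds) = d ≤ suc d' × Admissible (d' ∷ ds)

canon : ∀ {k} → Vec ℕ k → Tree (suc k)
canon []       = leaf
canon (d ∷ ds) = insert d (canon ds)

canonDepths : ∀ {k} → Vec ℕ k → Vec (ℕ × ℕ) (suc k)
canonDepths []       = (0 , 0) ∷ []
canonDepths (d ∷ ds) = (suc d , 0) ∷ bump d (canonDepths ds)

leftSpine-canon : ∀ {k} d (ds : Vec ℕ k) → Admissible (d ∷ ds) → leftSpine (canon (d ∷ ds)) ≡ suc d
leftSpine-canon d []        refl           = refl
leftSpine-canon d (d' ∷ ds) (d≤1+d' , adm) =
  leftSpine-insert d (canon (d' ∷ ds)) (subst (d ≤_) (sym (leftSpine-canon d' ds adm)) d≤1+d')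

depths-canon : ∀ {k} (ds : Vec ℕ k) → Admissible ds → depths (canon ds) ≡ canonDepths ds
depths-canon []            _              = refl
depths-canon (d ∷ [])      refl           = refl
depths-canon (d ∷ d' ∷ ds) (d≤1+d' , adm) = begin
  depths (insert d (canon (d' ∷ ds)))
    ≡⟨ depths-insert d _ (subst (d ≤_) (sym (leftSpine-canon d' ds adm)) d≤1+d') ⟩
  (suc d , 0) ∷ bump d (depths (canon (d' ∷ ds)))
    ≡⟨ cong (λ D → (suc d , 0) ∷ bump d D) (depths-canon (d' ∷ ds) adm) ⟩
  (suc d , 0) ∷ bump d (canonDepths (d' ∷ ds)) ∎
  where open ≡-Reasoning

canonDepths-ld : ∀ {k} (ds : Vec ℕ k) i →
  lookup (map proj₁ (canonDepths ds)) (inject₁ i) ≡ suc (lookup ds i)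
canonDepths-ld (d ∷ ds) i rewrite map-proj₁-bump d (canonDepths ds) with i
... | zero   = refl
... | suc i' = canonDepths-ld ds i'

canonDepths-ld-agree : ∀ {k} j (ds ds' : Vec ℕ k) → AgreeUpTo j ds ds' →
  AgreeUpTo j (map proj₁ (canonDepths ds)) (map proj₁ (canonDepths ds'))
canonDepths-ld-agree zero    []       []         _ = tt
canonDepths-ld-agree zero    (_ ∷ _)  (_ ∷ _)    _ = tt
canonDepths-ld-agree (suc j) []       []         _ = refl , tt
canonDepths-ld-agree (suc j) (d ∷ ds) (d' ∷ ds') (d≡d' , agree)
  rewrite map-proj₁-bump d (canonDepths ds) | map-proj₁-bump d' (canonDepths ds') =
  cong suc d≡d' , canonDepths-ld-agree j ds ds' agree

canonDepths-rd : ∀ {k} (ds ds' : Vec ℕ k) i → AgreeUpTo (toℕ i) ds ds' →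
  proj₂ (lookup (canonDepths ds) i) ≡ proj₂ (lookup (canonDepths ds') i)
canonDepths-rd []       []         zero    _              = refl
canonDepths-rd (d ∷ ds) (d' ∷ ds') zero    _              = refl
canonDepths-rd (d ∷ ds) (.d ∷ ds') (suc i) (refl , agree) =
  bump-rd d (canonDepths ds) (canonDepths ds') i
    (canonDepths-ld-agree (toℕ i) ds ds' agree) (canonDepths-rd ds ds' i agree)

ld-canon : ∀ {k} (ds : Vec ℕ k) → Admissible ds → ∀ i → ld (canon ds) (inject₁ i) ≡ suc (lookup ds i)
ld-canon ds adm i rewrite depths-canon ds adm =
  trans (sym (Vecₚ.lookup-map (inject₁ i) proj₁ (canonDepths ds))) (canonDepths-ld ds i)

rd-canon-prefix : ∀ {k} (ds ds' : Vec ℕ k) → Admissible ds → Admissible ds' →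
  ∀ i → AgreeUpTo (toℕ i) ds ds' → rd (canon ds) i ≡ rd (canon ds') i
rd-canon-prefix ds ds' adm adm' i agree rewrite depths-canon ds adm | depths-canon ds' adm' =
  canonDepths-rd ds ds' i agree

-- Right depths read backwards

rdVec : ∀ {n} → Tree n → Vec ℕ n
rdVec T = map proj₂ (depths T)

rdVec-node : ∀ {i j} (A : Tree i) (B : Tree j) → rdVec (node A B) ≡ rdVec A ++ map suc (rdVec B)
rdVec-node A B = begin
  map proj₂ (map (map₁ suc) (depths A) ++ map (map₂ suc) (depths B))
    ≡⟨ Vecₚ.map-++ proj₂ (map (map₁ suc) (depths A)) _ ⟩
  map proj₂ (map (map₁ suc) (depths A)) ++ map proj₂ (map (map₂ suc) (depths B))
    ≡⟨ cong₂ _++_ (sym (Vecₚ.map-∘ proj₂ (map₁ suc) (depths A)))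
                  (trans (sym (Vecₚ.map-∘ proj₂ (map₂ suc) (depths B)))
                         (Vecₚ.map-∘ suc proj₂ (depths B))) ⟩
  rdVec A ++ map suc (rdVec B) ∎
  where open ≡-Reasoning

LeftDepthShape : ℕ → List ℕ → Set
LeftDepthShape c List.[]                 = ⊥
LeftDepthShape c (t List.∷ List.[])      = t ≡ c
LeftDepthShape c (t List.∷ t' List.∷ ts) = 1 ≤ t × t ≤ suc t' × LeftDepthShape c (t' List.∷ ts)

LeftDepthShape-map-suc : ∀ c ts → LeftDepthShape c ts → LeftDepthShape (suc c) (List.map suc ts)
LeftDepthShape-map-suc c (t List.∷ List.[])      refl               = refl
LeftDepthShape-map-suc c (t List.∷ t' List.∷ ts) (_ , t≤1+t' , sh) =
  s≤s z≤n , s≤s t≤1+t' , LeftDepthShape-map-suc c (t' List.∷ ts) sh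

LeftDepthShape-++ : ∀ c ts us → LeftDepthShape 1 ts → LeftDepthShape c us →
  LeftDepthShape c (ts List.++ us)
LeftDepthShape-++ c (t List.∷ List.[])      (u List.∷ us) refl                sh' =
  ℕ.≤-refl , s≤s z≤n , sh'
LeftDepthShape-++ c (t List.∷ t' List.∷ ts) us            (1≤t , t≤1+t' , sh) sh' =
  1≤t , t≤1+t' , LeftDepthShape-++ c (t' List.∷ ts) us sh sh'

reverse-rdList-node : ∀ {i j} (A : Tree i) (B : Tree j) →
  List.reverse (toList (rdVec (node A B)))
    ≡ List.map suc (List.reverse (toList (rdVec B))) List.++ List.reverse (toList (rdVec A))
reverse-rdList-node A B = begin
  List.reverse (toList (rdVec (node A B)))
    ≡⟨ cong (List.reverse ∘ toList) (rdVec-node A B) ⟩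
  List.reverse (toList (rdVec A ++ map suc (rdVec B)))
    ≡⟨ cong List.reverse (trans (Vecₚ.toList-++ (rdVec A) _)
                                (cong (toList (rdVec A) List.++_) (Vecₚ.toList-map suc (rdVec B)))) ⟩
  List.reverse (toList (rdVec A) List.++ List.map suc (toList (rdVec B)))
    ≡⟨ Listₚ.reverse-++ (toList (rdVec A)) _ ⟩
  List.reverse (List.map suc (toList (rdVec B))) List.++ List.reverse (toList (rdVec A))
    ≡⟨ cong (List._++ _) (sym (Listₚ.reverse-map suc (toList (rdVec B)))) ⟩
  List.map suc (List.reverse (toList (rdVec B))) List.++ List.reverse (toList (rdVec A)) ∎
  where open ≡-Reasoning

reverse-rdVec-shape : ∀ {n} (T : Tree n) → LeftDepthShape 0 (toList (reverse (rdVec T)))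
reverse-rdVec-shape T = subst (LeftDepthShape 0) (sym (Vecₚ.toList-reverse (rdVec T))) (shape T)
  where
  shape : ∀ {n} (T : Tree n) → LeftDepthShape 0 (List.reverse (toList (rdVec T)))
  shape leaf       = refl
  shape (node A B) = subst (LeftDepthShape 0) (sym (reverse-rdList-node A B))
    (LeftDepthShape-++ 0 _ _ (LeftDepthShape-map-suc 0 _ (shape B)) (shape A))

-- The greedy code of a tree

module Greedy (m : ℤ) where

  -- A record, so that the endpoints of a congruence can be inferred.
  record _≈_ (x y : ℕ) : Set where
    constructor mod
    field unmod : (+ x) ≡ (+ y) [mod m ]
  open _≈_ public

  ≈-refl : ∀ {x} → x ≈ x
  ≈-refl {x} = mod (≡-mod-refl m (+ x))

  ≈-sym : ∀ {x y} → x ≈ y → y ≈ x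
  ≈-sym {x} {y} (mod x≡y) = mod (≡-mod-sym m (+ x) (+ y) x≡y)

  ≈-trans : ∀ {x y z} → x ≈ y → y ≈ z → x ≈ z
  ≈-trans {x} {y} {z} (mod x≡y) (mod y≡z) = mod (≡-mod-trans m (+ x) (+ y) (+ z) x≡y y≡z)

  RCong⇒Pointwise : ∀ {n} (T T' : Tree n) → RCong m T T' → Pointwise _≈_ (rdVec T) (rdVec T')
  RCong⇒Pointwise T T' T≡T' = Ext.extensional⇒inductive (Ext.ext λ i →
    subst₂ _≈_ (sym (Vecₚ.lookup-map i proj₂ (depths T))) (sym (Vecₚ.lookup-map i proj₂ (depths T')))
      (mod (T≡T' i)))

  Pointwise⇒RCong : ∀ {n} (T T' : Tree n) → Pointwise _≈_ (rdVec T) (rdVec T') → RCong m T T'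
  Pointwise⇒RCong T T' rds≈ i = unmod
    (subst₂ _≈_ (Vecₚ.lookup-map i proj₂ (depths T)) (Vecₚ.lookup-map i proj₂ (depths T'))
      (Pw.lookup rds≈ i))

  Encodes : ℕ → ℕ → Set
  Encodes t v = suc v ≈ t

  encodes? : ∀ t → Decidable (Encodes t)
  encodes? t v = map′ mod unmod (ℕ._∣?_ ℤ.∣ m ∣ ℤ.∣ + suc v - + t ∣)

  encodes-resp-≈ : ∀ {t t'} → t ≈ t' → Encodes t ≐ Encodes t'
  encodes-resp-≈ t≈t' = (λ e → ≈-trans e t≈t') , (λ e → ≈-trans e (≈-sym t≈t'))

  firstCode : ℕ → ℕ → ℕ → ℕ
  firstCode t = firstFrom (encodes? t)

  -- The search window has the same length for all targets of a given
  -- position, so the choice depends only on the residues of the targets.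
  greedy : ∀ {k} → ℕ → Vec ℕ (suc k) → Vec ℕ k
  greedy         lb (t ∷ [])      = []
  greedy {suc k} lb (t ∷ t' ∷ ts) =
    firstCode t lb (suc k) ∷ greedy (pred (firstCode t lb (suc k))) (t' ∷ ts)

  Shaped : ∀ {k} → Vec ℕ k → Set
  Shaped ts = LeftDepthShape 0 (toList ts)

  shaped-head-≤-length : ∀ {k} t (ts : Vec ℕ k) → Shaped (t ∷ ts) → t ≤ k
  shaped-head-≤-length t []        refl              = z≤n
  shaped-head-≤-length t (t' ∷ ts) (_ , t≤1+t' , sh) =
    ℕ.≤-trans t≤1+t' (s≤s (shaped-head-≤-length t' ts sh))

  firstCode-spec : ∀ {k} t t' (ts : Vec ℕ k) lb → Shaped (t ∷ t' ∷ ts) → lb ≤ pred t →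
    let v = firstCode t lb (suc k) in Encodes t v × lb ≤ v × v ≤ pred t
  firstCode-spec (suc t) t' ts lb sh lb≤t =
    firstFrom-spec (encodes? (suc t)) lb≤t t<lb+1+k ≈-refl
    where t<lb+1+k = ℕ.≤-trans (shaped-head-≤-length (suc t) _ sh) (ℕ.m≤n+m _ lb)

  pred-≤-next : ∀ {v t t'} → v ≤ pred t → t ≤ suc t' → pred v ≤ pred t'
  pred-≤-next v≤t-1 t≤1+t' = ℕ.pred-mono-≤ (ℕ.≤-trans v≤t-1 (ℕ.pred-mono-≤ t≤1+t'))

  greedy-encodes : ∀ {k} lb (ts : Vec ℕ (suc k)) → Shaped ts → lb ≤ pred (head ts) →
    ∀ i → Encodes (lookup ts (inject₁ i)) (lookup (greedy lb ts) i)
  greedy-encodes lb (t ∷ t' ∷ ts) sh lb≤t-1 zero = proj₁ (firstCode-spec t t' ts lb sh lb≤t-1)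
  greedy-encodes lb (t ∷ t' ∷ ts) sh@(_ , t≤1+t' , sh') lb≤t-1 (suc i) =
    greedy-encodes _ (t' ∷ ts) sh' (pred-≤-next v≤t-1 t≤1+t') i
    where v≤t-1 = proj₂ (proj₂ (firstCode-spec t t' ts lb sh lb≤t-1))

  greedy-admissible : ∀ {k} lb (ts : Vec ℕ (suc k)) → Shaped ts → lb ≤ pred (head ts) →
    Admissible (greedy lb ts)
  greedy-admissible lb (t ∷ [])      _ _ = tt
  greedy-admissible lb (t ∷ t' ∷ []) sh@(_ , t≤1+t' , refl) lb≤t-1 =
    ℕ.n≤0⇒n≡0 (ℕ.≤-trans (proj₂ (proj₂ (firstCode-spec t t' [] lb sh lb≤t-1)))
                         (ℕ.pred-mono-≤ t≤1+t'))
  greedy-admissible lb (t ∷ t' ∷ t'' ∷ ts) sh@(_ , t≤1+t' , sh') lb≤t-1 =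
    v≤1+v' , greedy-admissible (pred v) (t' ∷ t'' ∷ ts) sh' v-1≤t'-1
    where
    v = firstCode t lb _
    v-1≤t'-1 = pred-≤-next (proj₂ (proj₂ (firstCode-spec t t' _ lb sh lb≤t-1))) t≤1+t'
    v≤1+v' : v ≤ suc (firstCode t' (pred v) _)
    v≤1+v' with v | proj₁ (proj₂ (firstCode-spec t' t'' ts (pred v) sh' v-1≤t'-1))
    ... | zero  | _      = z≤n
    ... | suc _ | v-1≤v' = s≤s v-1≤v'

  greedy-cong : ∀ {k} lb {ts ts' : Vec ℕ (suc k)} → Pointwise _≈_ ts ts' → greedy lb ts ≡ greedy lb ts'
  greedy-cong lb (_ ∷ []) = refl
  greedy-cong lb {t ∷ ts@(_ ∷ _)} {t' ∷ _ ∷ _} (t≈t' ∷ ts≈ts') =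
    trans (cong (λ v → v ∷ greedy (pred v) ts) v≡v') (cong (_ ∷_) (greedy-cong _ ts≈ts'))
    where v≡v' = firstFrom-cong (encodes? t) (encodes? t') (encodes-resp-≈ t≈t') lb _

  greedy-injective : ∀ {k} {lb lb'} (ts ts' : Vec ℕ (suc k)) → lb ≡ lb' →
    Shaped ts → Shaped ts' → lb ≤ pred (head ts) → lb' ≤ pred (head ts') →
    greedy lb ts ≡ greedy lb' ts' → Pointwise _≈_ ts ts'
  greedy-injective (t ∷ []) (t' ∷ []) _ refl refl _ _ _ = ≈-refl ∷ []
  greedy-injective {lb = lb} (t ∷ t₂ ∷ ts) (t' ∷ t₂' ∷ ts') refl
    sh@(_ , t≤1+t₂ , sh₂) sh'@(_ , t'≤1+t₂' , sh₂') lb≤t-1 lb≤t'-1 eq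
    with Vecₚ.∷-injective eq
  ... | v≡v' , rest =
    ≈-trans (≈-sym (proj₁ spec)) (subst (Encodes t') (sym v≡v') (proj₁ spec')) ∷
    greedy-injective (t₂ ∷ ts) (t₂' ∷ ts') (cong pred v≡v') sh₂ sh₂'
      (pred-≤-next (proj₂ (proj₂ spec)) t≤1+t₂) (pred-≤-next (proj₂ (proj₂ spec')) t'≤1+t₂') rest
    where
    spec  = firstCode-spec t t₂ ts lb sh lb≤t-1
    spec' = firstCode-spec t' t₂' ts' lb sh' lb≤t'-1

  greedy-determined : ∀ {k} {lb lb'} (ts ts' : Vec ℕ (suc k)) → lb ≡ lb' → ∀ i →
    AgreeUpTo (toℕ i) (greedy lb ts) (greedy lb' ts') → lookup ts (inject₁ i) ≈ lookup ts' (inject₁ i) →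
    lookup (greedy lb ts) i ≡ lookup (greedy lb' ts') i
  greedy-determined {lb = lb} (t ∷ _ ∷ _) (t' ∷ _ ∷ _) refl zero _ t≈t' =
    firstFrom-cong (encodes? t) (encodes? t') (encodes-resp-≈ t≈t') lb _
  greedy-determined (_ ∷ t₂ ∷ ts) (_ ∷ t₂' ∷ ts') refl (suc i) (v≡v' , agree) =
    greedy-determined (t₂ ∷ ts) (t₂' ∷ ts') (cong pred v≡v') i agree

  targets : ∀ {n} → Tree (suc n) → Vec ℕ (suc n)
  targets T = reverse (rdVec T)

  code : ∀ {n} → Tree (suc n) → Vec ℕ n
  code T = greedy 0 (targets T)

  code-admissible : ∀ {n} (T : Tree (suc n)) → Admissible (code T)
  code-admissible T = greedy-admissible 0 (targets T) (reverse-rdVec-shape T) z≤n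

  code-encodes : ∀ {n} (T : Tree (suc n)) i → Encodes (lookup (targets T) (inject₁ i)) (lookup (code T) i)
  code-encodes T = greedy-encodes 0 (targets T) (reverse-rdVec-shape T) z≤n

  RCong⇒code-≡ : ∀ {n} (T T' : Tree (suc n)) → RCong m T T' → code T ≡ code T'
  RCong⇒code-≡ T T' T≡T' = greedy-cong 0 (reverse⁺ (RCong⇒Pointwise T T' T≡T'))

  code-≡⇒RCong : ∀ {n} (T T' : Tree (suc n)) → code T ≡ code T' → RCong m T T'
  code-≡⇒RCong T T' eq = Pointwise⇒RCong T T' (reverse⁻
    (greedy-injective (targets T) (targets T') refl
      (reverse-rdVec-shape T) (reverse-rdVec-shape T') z≤n z≤n eq))

  ABCong-canon⇒code-≡ : ∀ a b → gcd a m ≡ 1ℤ → ∀ {n} (T T' : Tree (suc n)) →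
    ABCong a b m (canon (code T)) (canon (code T')) → code T ≡ code T'
  ABCong-canon⇒code-≡ a b gcd≡1 T T' S≡S' = ≡-from-prefixes (code T) (code T') λ i agree →
    let agree′ = subst (λ l → AgreeUpTo l (code T) (code T')) (sym (toℕ-inject₁ i)) agree
        ld≡ld′ = ABCong⇒ld-≡-mod a b m gcd≡1 (canon (code T)) (canon (code T')) (inject₁ i)
          (rd-canon-prefix (code T) (code T') (code-admissible T) (code-admissible T') (inject₁ i) agree′)
          S≡S'
        code≈code′ : suc (lookup (code T) i) ≈ suc (lookup (code T') i)
        code≈code′ = mod (subst₂ (λ x y → (+ x) ≡ (+ y) [mod m ])
          (ld-canon (code T) (code-admissible T) i) (ld-canon (code T') (code-admissible T') i) ld≡ld′)
    in greedy-determined (targets T) (targets T') refl i agree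
         (≈-trans (≈-sym (code-encodes T i)) (≈-trans code≈code′ (code-encodes T' i)))

lemma3p7 : (a b m : ℤ) → gcd a m ≡ 1ℤ → (n : ℕ) →
    Σ (Tree (suc n) → Tree (suc n)) (λ f →
      Congruent (RCong m) (ABCong a b m) f × Injective (RCong m) (ABCong a b m) f)
lemma3p7 a b m gcd≡1 n = canon ∘ code , (λ {T} {T'} → respects T T') , (λ {T} {T'} → reflects T T')
  where
  open Greedy m
  respects : ∀ T T' → RCong m T T' → ABCong a b m (canon (code T)) (canon (code T'))
  respects T T' T≡T' =
    subst (ABCong a b m (canon (code T))) (cong canon (RCong⇒code-≡ T T' T≡T'))
      (ABCong-refl a b m (canon (code T)))
  reflects : ∀ T T' → ABCong a b m (canon (code T)) (canon (code T')) → RCong m T T'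
  reflects T T' S≡S' = code-≡⇒RCong T T' (ABCong-canon⇒code-≡ a b gcd≡1 T T' S≡S')
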